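{- Let $m \ge 3$ and $m' \ge 3$ be integers such that $m'-2 = k(m-2)$ for some positive integer $k$. If $n_m = p\,(m-2)^{m-2}$ for a real number $p$, then $n_{m'} \le p\,(m'-2)^{m'-2}$. Equivalently, $\dfrac{n_{m'}}{(m'-2)^{m'-2}} \le \dfrac{n_m}{(m-2)^{m-2}}$.
   Context: For a graph $G$, a $k$-list assignment $L$ assigns to each vertex $v$ a set $L(v)$ of exactly $k$ colors; a proper $L$-coloring chooses $c(v)\in L(v)$ for each $v$ with adjacent vertices receiving different colors. The choice number $ch(G)$ is the least $k$ such that for every $k$-list assignment $L$ of $G$ there is a proper $L$-coloring. $K_{m,n}$ denotes the complete bipartite graph with parts of sizes $m$ and $n$. For an integer $m\ge 3$, $n_m$ denotes the smallest positive integer $n$ such that $ch(K_{m,n}) = m-1$. -}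

module Defs where

open import Data.Nat using (ℕ; zero; suc; _<_; _≤_; _∸_; _*_; _^_)
open import Data.Fin using (Fin)
open import Data.Sum using (_⊎_; inj₁; inj₂)
open import Data.Product using (Σ; _×_; ∃)
open import Data.Empty using (⊥)
open import Data.Unit using (⊤)
open import Function.Definitions using (Injective)
open import Relation.Binary.PropositionalEquality using (_≡_; _≢_)
open import Relation.Nullary using (¬_)

record Graph : Set₁ where
  field
    V   : Set
    Adj : V → V → Set
open Graph public

record ListAssignment (G : Graph) (k : ℕ) : Set where
  field
    L     : V G → Fin k → ℕ
    L-inj : ∀ v → Injective _≡_ _≡_ (L v)
open ListAssignment public

ProperLColouring : (G : Graph) {k : ℕ} → ListAssignment G k → (V G → ℕ) → Set
ProperLColouring G A c =
  (∀ v → ∃ λ i → c v ≡ L A v i) × (∀ u v → Adj G u v → c u ≢ c v)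

Choosable : Graph → ℕ → Set
Choosable G k = (A : ListAssignment G k) → ∃ λ c → ProperLColouring G A c

ChoiceNumberIs : Graph → ℕ → Set
ChoiceNumberIs G k = Choosable G k × (∀ j → j < k → ¬ Choosable G j)

KAdj : {m n : ℕ} → Fin m ⊎ Fin n → Fin m ⊎ Fin n → Set
KAdj (inj₁ _) (inj₂ _) = ⊤
KAdj (inj₂ _) (inj₁ _) = ⊤
KAdj (inj₁ _) (inj₁ _) = ⊥
KAdj (inj₂ _) (inj₂ _) = ⊥

K : ℕ → ℕ → Graph
K m n = record { V = Fin m ⊎ Fin n ; Adj = KAdj }

IsNm : ℕ → ℕ → Set
IsNm m n = 1 ≤ n × ChoiceNumberIs (K m n) (m ∸ 1)
         × (∀ n' → 1 ≤ n' → n' < n → ¬ ChoiceNumberIs (K m n') (m ∸ 1))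

{-# OPTIONS --safe #-}
-- Write d = m − 2, s = m' − 2 = (k+1)d, e = kd and N = n_m (k+1)^d s^e.  An
-- s-colouring of every s-list assignment of K_{m+e,N} yields a d-colouring of every
-- d-list assignment A of K_{m,n_m}: each left vertex keeps its d colours, each in
-- k+1 tagged copies (c, j); e new left vertices get disjoint fresh palettes of size
-- s; each right vertex b is replaced by one copy for every choice σ of a tag per
-- colour of b and every choice τ of one fresh colour per new vertex, listing b's
-- colours tagged by σ together with the fresh colours chosen by τ.  The new vertices
-- fix τ, and when σ repeats the tags the left side uses on equal colours, the copy
-- of b must take some (c, σ c) with c unused on the left, so c may colour b.  Since
-- K_{m,n_m} is not d-choosable, K_{m',N} is not s-choosable; adding one right vertex
-- raises the choice number by at most one, so n_{m'} ≤ N, and N d^d = n_m s^s.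
module Submission where

open import Defs
open import Algebra.Properties.CommutativeSemigroup using (xy∙z≈xz∙y)
open import Data.Empty using (⊥-elim)
open import Data.Fin using (Fin; zero; suc; toℕ; inject≤; punchIn; splitAt; _↑ˡ_; _↑ʳ_; remQuot; quotient; remainder; combine; finToFun; funToFin)
open import Data.Fin.Properties using (any?; toℕ<n; toℕ-injective; inject≤-injective; punchIn-injective; punchInᵢ≢i; splitAt-↑ˡ; splitAt-↑ʳ; +↔⊎; *↔×; remQuot-combine; combine-injective; finToFun-funToFin)
open import Data.Nat using (ℕ; zero; suc; _+_; _*_; _^_; _∸_; _≤_; _<_; z≤n; s≤s; s≤s⁻¹)
open import Data.Nat.DivMod using (_%_; [m+kn]%n≡m%n; m<n⇒m%n≡m)
open import Data.Nat.Properties using (_≟_; ≤-refl; ≤-trans; ≤-<-trans; <-≤-trans; <⇒≢; ≮⇒≥; n≤1+n; n<1+n; m≤m+n; +-cancelˡ-≡; *-cancelʳ-≡; *-assoc; *-monoˡ-≤; ^-distribˡ-+-*; [m*n]*[o*p]≡[m*o]*[n*p]; *-commutativeSemigroup; module ≤-Reasoning)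
open import Data.Product using (Σ; ∃; _×_; _,_; proj₁; proj₂; swap)
open import Data.Sum using (_⊎_; inj₁; inj₂; map₂)
open import Data.Unit using (tt)
open import Function using (_∘_; Injection)
open import Function.Definitions using (Injective)
open import Function.Properties.Inverse using (↔⇒↣)
open import Relation.Binary.PropositionalEquality using (_≡_; _≢_; refl; sym; trans; cong; cong₂; _≗_; module ≡-Reasoning)
open import Relation.Nullary using (¬_; yes; no)

splitAt-injective : ∀ m {n} → Injective _≡_ _≡_ (splitAt m {n})
splitAt-injective m = Injection.injective (↔⇒↣ +↔⊎)

remQuot-injective : ∀ {m} n → Injective _≡_ _≡_ (remQuot {m} n)
remQuot-injective n = Injection.injective (↔⇒↣ *↔×)

toℕ+*-injective : ∀ {q} (i j : Fin q) a b → toℕ i + a * q ≡ toℕ j + b * q → i ≡ j × a ≡ b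
toℕ+*-injective {suc q} i j a b eq = i≡j , *-cancelʳ-≡ a b (suc q) (+-cancelˡ-≡ (toℕ i) _ _ eq′)
  where
  remainder-is : ∀ i a → (toℕ i + a * suc q) % suc q ≡ toℕ i
  remainder-is i a = trans ([m+kn]%n≡m%n (toℕ i) a (suc q)) (m<n⇒m%n≡m (toℕ<n i))
  i≡j : i ≡ j
  i≡j = toℕ-injective (trans (sym (remainder-is i a)) (trans (cong (_% suc q) eq) (remainder-is j b)))
  eq′ : toℕ i + a * suc q ≡ toℕ i + b * suc q
  eq′ = trans eq (cong (λ x → toℕ x + b * suc q) (sym i≡j))

^-distrib-* : ∀ m n o → (m * n) ^ o ≡ m ^ o * n ^ o
^-distrib-* m n zero = refl
^-distrib-* m n (suc o) = begin
  m * n * (m * n) ^ o      ≡⟨ cong (m * n *_) (^-distrib-* m n o) ⟩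
  m * n * (m ^ o * n ^ o)  ≡⟨ [m*n]*[o*p]≡[m*o]*[n*p] m n (m ^ o) (n ^ o) ⟩
  m * m ^ o * (n * n ^ o)  ∎
  where open ≡-Reasoning

m^n*[m*n]^o*n^n≡[m*n]^[n+o] : ∀ m n o → m ^ n * (m * n) ^ o * n ^ n ≡ (m * n) ^ (n + o)
m^n*[m*n]^o*n^n≡[m*n]^[n+o] m n o = begin
  m ^ n * (m * n) ^ o * n ^ n  ≡⟨ xy∙z≈xz∙y *-commutativeSemigroup (m ^ n) _ _ ⟩
  m ^ n * n ^ n * (m * n) ^ o  ≡⟨ cong (_* (m * n) ^ o) (sym (^-distrib-* m n n)) ⟩
  (m * n) ^ n * (m * n) ^ o    ≡⟨ sym (^-distribˡ-+-* (m * n) n o) ⟩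
  (m * n) ^ (n + o)            ∎
  where open ≡-Reasoning

pullback : ∀ {G H k} → (V H → V G) → ListAssignment G k → ListAssignment H k
pullback f A = record { L = L A ∘ f ; L-inj = L-inj A ∘ f }

truncate : ∀ {G j k} → j ≤ k → ListAssignment G k → ListAssignment G j
truncate j≤k A = record
  { L = λ v i → L A v (inject≤ i j≤k)
  ; L-inj = λ v → inject≤-injective j≤k j≤k _ _ ∘ L-inj A v
  }

Choosable-mono : ∀ {G j k} → j ≤ k → Choosable G j → Choosable G k
Choosable-mono j≤k ch A =
  let (c , member , proper) = ch (truncate j≤k A)
  in c , (λ v → let (i , c≡) = member v in inject≤ i j≤k , c≡) , proper

module _ {G : Graph} {r : ℕ} (A : ListAssignment G (suc r)) (c : ℕ) where

  private
    slotOf : V G → Fin (suc r)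
    slotOf v with any? (λ i → L A v i ≟ c)
    ... | yes (i , _) = i
    ... | no _ = zero

    slotOf-correct : ∀ v i → L A v i ≡ c → slotOf v ≡ i
    slotOf-correct v i Lvi≡c with any? (λ i → L A v i ≟ c)
    ... | yes (j , Lvj≡c) = L-inj A v (trans Lvj≡c (sym Lvi≡c))
    ... | no none = ⊥-elim (none (i , Lvi≡c))

  avoiding : ListAssignment G r
  avoiding = record
    { L = λ v → L A v ∘ punchIn (slotOf v)
    ; L-inj = λ v → punchIn-injective (slotOf v) _ _ ∘ L-inj A v
    }

  avoiding-avoids : ∀ v j → L avoiding v j ≢ c
  avoiding-avoids v j eq = punchInᵢ≢i (slotOf v) j (sym (slotOf-correct v _ eq))

K-zero-choosable : ∀ {m r} → Choosable (K m 0) (suc r)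
K-zero-choosable A = (λ v → L A v zero) , (λ v → zero , refl) , proper
  where
  proper : ∀ u v → KAdj u v → L A u zero ≢ L A v zero
  proper (inj₁ _) (inj₁ _) ()

K-suc-choosable : ∀ {m n r} → Choosable (K m n) r → Choosable (K m (suc n)) (suc r)
K-suc-choosable {m} {n} {r} ch A = extend (ch A′)
  where
  c₀ : ℕ
  c₀ = L A (inj₂ zero) zero

  A′ : ListAssignment (K m n) r
  A′ = pullback (map₂ suc) (avoiding A c₀)

  extend : (∃ λ c′ → ProperLColouring (K m n) A′ c′) →
           ∃ λ c → ProperLColouring (K m (suc n)) A c
  extend (c′ , member′ , proper′) = colour , member , proper
    where
    colour : Fin m ⊎ Fin (suc n) → ℕ
    colour (inj₂ zero) = c₀
    colour (inj₁ a) = c′ (inj₁ a)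
    colour (inj₂ (suc b)) = c′ (inj₂ b)

    member : ∀ v → ∃ λ i → colour v ≡ L A v i
    member (inj₂ zero) = zero , refl
    member (inj₁ a) = _ , proj₂ (member′ (inj₁ a))
    member (inj₂ (suc b)) = _ , proj₂ (member′ (inj₂ b))

    a≢c₀ : ∀ a → colour (inj₁ a) ≢ c₀
    a≢c₀ a eq = let (i , c≡) = member′ (inj₁ a) in
      avoiding-avoids A c₀ (inj₁ a) i (trans (sym c≡) eq)

    proper : ∀ u v → KAdj u v → colour u ≢ colour v
    proper (inj₁ a) (inj₂ zero) _ = a≢c₀ a
    proper (inj₂ zero) (inj₁ a) _ = a≢c₀ a ∘ sym
    proper (inj₁ a) (inj₂ (suc b)) = proper′ (inj₁ a) (inj₂ b)
    proper (inj₂ (suc b)) (inj₁ a) = proper′ (inj₂ b) (inj₁ a)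

ChoiceNumberIs-K-suc : ∀ {m n r} → Choosable (K m n) r → ¬ Choosable (K m (suc n)) r →
                       ChoiceNumberIs (K m (suc n)) (suc r)
ChoiceNumberIs-K-suc ch ¬ch = K-suc-choosable ch , λ j j<1+r chj → ¬ch (Choosable-mono (s≤s⁻¹ j<1+r) chj)

IsNm⇒¬Choosable : ∀ {d n} → IsNm (2 + d) n → ¬ Choosable (K (2 + d) n) d
IsNm⇒¬Choosable (_ , (_ , not-smaller) , _) = not-smaller _ (n<1+n _)

IsNm-≤ : ∀ {r n N} → IsNm (3 + r) n → ¬ Choosable (K (3 + r) N) (suc r) → n ≤ N
IsNm-≤ {r} {n} {N} (_ , _ , minimal) ¬ch = ≮⇒≥ λ N<n → ¬¬choosable N<n N ≤-refl ¬ch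
  where
  -- choosability is not decidable, so the descent from N to 0 runs under ¬ ¬
  ¬¬choosable : N < n → ∀ j → j ≤ N → ¬ ¬ Choosable (K (3 + r) j) (suc r)
  ¬¬choosable _ zero _ ¬ch₀ = ¬ch₀ K-zero-choosable
  ¬¬choosable N<n (suc j) 1+j≤N ¬ch₁ = ¬¬choosable N<n j (≤-trans (n≤1+n j) 1+j≤N) λ chj →
    minimal (suc j) (s≤s z≤n) (≤-<-trans 1+j≤N N<n) (ChoiceNumberIs-K-suc chj ¬ch₁)

module Blowup (m n d k : ℕ) where

  q e s N : ℕ
  q = suc k
  e = k * d
  -- definitionally d + e, so that splitAt d sorts the list of a right vertex
  s = q * d
  N = n * (q ^ d * s ^ e)

  tagged : ℕ → Fin q → ℕ
  tagged c j = e * s + (toℕ j + c * q)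

  fresh : Fin e → Fin s → ℕ
  fresh t x = toℕ (combine t x)

  tagged-injective : ∀ {c c′ j j′} → tagged c j ≡ tagged c′ j′ → c ≡ c′ × j ≡ j′
  tagged-injective {c} {c′} {j} {j′} eq = swap (toℕ+*-injective j j′ c c′ (+-cancelˡ-≡ (e * s) _ _ eq))

  fresh-injective : ∀ {t t′ x x′} → fresh t x ≡ fresh t′ x′ → t ≡ t′ × x ≡ x′
  fresh-injective {t} {t′} {x} {x′} eq = combine-injective t x t′ x′ (toℕ-injective eq)

  fresh≢tagged : ∀ t x c j → fresh t x ≢ tagged c j
  fresh≢tagged t x c j = <⇒≢ (<-≤-trans (toℕ<n (combine t x)) (m≤m+n (e * s) _))

  owner : Fin N → Fin n
  owner = quotient (q ^ d * s ^ e)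

  codes : Fin N → Fin (q ^ d) × Fin (s ^ e)
  codes y = remQuot (s ^ e) (remainder {n} (q ^ d * s ^ e) y)

  tags : Fin N → Fin d → Fin q
  tags = finToFun ∘ proj₁ ∘ codes

  picks : Fin N → Fin e → Fin s
  picks = finToFun ∘ proj₂ ∘ codes

  vertex : Fin n → (Fin d → Fin q) → (Fin e → Fin s) → Fin N
  vertex b σ τ = combine b (combine (funToFin σ) (funToFin τ))

  module _ (b : Fin n) (σ : Fin d → Fin q) (τ : Fin e → Fin s) where

    owner-vertex : owner (vertex b σ τ) ≡ b
    owner-vertex = cong proj₁ (remQuot-combine b _)

    codes-vertex : codes (vertex b σ τ) ≡ (funToFin σ , funToFin τ)
    codes-vertex = trans (cong (remQuot (s ^ e) ∘ proj₂) (remQuot-combine b _))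
                         (remQuot-combine (funToFin σ) (funToFin τ))

    tags-vertex : tags (vertex b σ τ) ≗ σ
    tags-vertex p = trans (cong (λ z → finToFun (proj₁ z) p) codes-vertex) (finToFun-funToFin σ p)

    picks-vertex : picks (vertex b σ τ) ≗ τ
    picks-vertex t = trans (cong (λ z → finToFun (proj₂ z) t) codes-vertex) (finToFun-funToFin τ t)

  module _ (A : ListAssignment (K m n) d) where

    leftL : Fin m ⊎ Fin e → Fin s → ℕ
    leftL (inj₁ a) i = tagged (L A (inj₁ a) (remainder {q} d i)) (quotient d i)
    leftL (inj₂ t) i = fresh t i

    rightL : Fin N → Fin d ⊎ Fin e → ℕ
    rightL y (inj₁ p) = tagged (L A (inj₂ (owner y)) p) (tags y p)
    rightL y (inj₂ t) = fresh t (picks y t)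

    leftL-injective : ∀ u → Injective _≡_ _≡_ (leftL u)
    leftL-injective (inj₁ a) eq =
      let (c≡ , j≡) = tagged-injective eq in remQuot-injective d (cong₂ _,_ j≡ (L-inj A (inj₁ a) c≡))
    leftL-injective (inj₂ t) eq = proj₂ (fresh-injective eq)

    rightL-injective : ∀ y → Injective _≡_ _≡_ (rightL y)
    rightL-injective y {inj₁ p} {inj₁ p′} eq = cong inj₁ (L-inj A (inj₂ (owner y)) (proj₁ (tagged-injective eq)))
    rightL-injective y {inj₂ t} {inj₂ t′} eq = cong inj₂ (proj₁ (fresh-injective eq))
    rightL-injective y {inj₁ p} {inj₂ t′} eq =
      ⊥-elim (fresh≢tagged t′ _ (L A (inj₂ (owner y)) p) (tags y p) (sym eq))
    rightL-injective y {inj₂ t} {inj₁ p′} eq =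
      ⊥-elim (fresh≢tagged t _ (L A (inj₂ (owner y)) p′) (tags y p′) eq)

    blownL : Fin (m + e) ⊎ Fin N → Fin s → ℕ
    blownL (inj₁ x) = leftL (splitAt m x)
    blownL (inj₂ y) = rightL y ∘ splitAt d

    blownL-injective : ∀ v → Injective _≡_ _≡_ (blownL v)
    blownL-injective (inj₁ x) = leftL-injective (splitAt m x)
    blownL-injective (inj₂ y) = splitAt-injective d ∘ rightL-injective y

    blown : ListAssignment (K (m + e) N) s
    blown = record { L = blownL ; L-inj = blownL-injective }

    module _ (c′ : Fin (m + e) ⊎ Fin N → ℕ)
             (member′ : ∀ v → ∃ λ i → c′ v ≡ blownL v i)
             (proper′ : ∀ u v → KAdj u v → c′ u ≢ c′ v) where

      old : Fin m → Fin (m + e) ⊎ Fin N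
      old a = inj₁ (a ↑ˡ e)

      new : Fin e → Fin (m + e) ⊎ Fin N
      new t = inj₁ (m ↑ʳ t)

      oldColour : Fin m → ℕ
      oldColour a = L A (inj₁ a) (remainder {q} d (proj₁ (member′ (old a))))

      oldTag : Fin m → Fin q
      oldTag a = quotient d (proj₁ (member′ (old a)))

      pick : Fin e → Fin s
      pick t = proj₁ (member′ (new t))

      c′-old : ∀ a → c′ (old a) ≡ tagged (oldColour a) (oldTag a)
      c′-old a = trans (proj₂ (member′ (old a)))
                       (cong (λ u → leftL u (proj₁ (member′ (old a)))) (splitAt-↑ˡ m a e))

      c′-new : ∀ t → c′ (new t) ≡ fresh t (pick t)
      c′-new t = trans (proj₂ (member′ (new t))) (cong (λ u → leftL u (pick t)) (splitAt-↑ʳ m e t))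

      tagOf : ℕ → Fin q
      tagOf c with any? (λ a → oldColour a ≟ c)
      ... | yes (a , _) = oldTag a
      ... | no _ = zero

      tagOf-used : ∀ {a c} → oldColour a ≡ c → ∃ λ a′ → c′ (old a′) ≡ tagged c (tagOf c)
      tagOf-used {a} {c} eq with any? (λ a → oldColour a ≟ c)
      ... | yes (a′ , eq′) = a′ , trans (c′-old a′) (cong (λ x → tagged x (oldTag a′)) eq′)
      ... | no none = ⊥-elim (none (a , eq))

      σ : Fin n → Fin d → Fin q
      σ b p = tagOf (L A (inj₂ b) p)

      copy : Fin n → Fin (m + e) ⊎ Fin N
      copy b = inj₂ (vertex b (σ b) pick)

      c′-copy : ∀ b → Σ (Fin d) λ p → c′ (copy b) ≡ tagged (L A (inj₂ b) p) (σ b p)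
      c′-copy b with splitAt d (proj₁ (member′ (copy b))) | proj₂ (member′ (copy b))
      ... | inj₁ p | eq = p , trans eq (cong₂ (λ b′ → tagged (L A (inj₂ b′) p))
                                              (owner-vertex b (σ b) pick) (tags-vertex b (σ b) pick p))
      ... | inj₂ t | eq = ⊥-elim (proper′ (new t) (copy b) tt
                            (trans (c′-new t) (sym (trans eq (cong (fresh t) (picks-vertex b (σ b) pick t))))))

      colour : Fin m ⊎ Fin n → ℕ
      colour (inj₁ a) = oldColour a
      colour (inj₂ b) = L A (inj₂ b) (proj₁ (c′-copy b))

      colour-inj₁≢inj₂ : ∀ a b → colour (inj₁ a) ≢ colour (inj₂ b)
      colour-inj₁≢inj₂ a b eq = let (a′ , a′-colour) = tagOf-used eq in
        proper′ (old a′) (copy b) tt (trans a′-colour (sym (proj₂ (c′-copy b))))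

      colouring : ∃ λ c → ProperLColouring (K m n) A c
      colouring = colour , member , proper
        where
        member : ∀ v → ∃ λ i → colour v ≡ L A v i
        member (inj₁ a) = _ , refl
        member (inj₂ b) = _ , refl
        proper : ∀ u v → KAdj u v → colour u ≢ colour v
        proper (inj₁ a) (inj₂ b) _ = colour-inj₁≢inj₂ a b
        proper (inj₂ b) (inj₁ a) _ = colour-inj₁≢inj₂ a b ∘ sym

Choosable-blowup : ∀ {m n} d k →
  Choosable (K (m + k * d) (n * (suc k ^ d * (suc k * d) ^ (k * d)))) (suc k * d) → Choosable (K m n) d
Choosable-blowup {m} {n} d k ch A =
  let (c′ , member′ , proper′) = ch (blown A) in colouring A c′ member′ proper′
  where open Blowup m n d k

theorem1 : (m m' k : ℕ) → 3 ≤ m → 3 ≤ m' → 1 ≤ k → m' ∸ 2 ≡ k * (m ∸ 2)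
    → (nm nm' : ℕ) → IsNm m nm → IsNm m' nm'
    → nm' * (m ∸ 2) ^ (m ∸ 2) ≤ nm * (m' ∸ 2) ^ (m' ∸ 2)
theorem1 1 _ _ (s≤s ()) _ _ _ _ _ _ _
theorem1 2 _ _ (s≤s (s≤s ())) _ _ _ _ _ _ _
theorem1 (suc (suc (suc d₀))) (suc (suc .(suc k * suc d₀))) (suc k) _ _ _ refl nm nm' Inm Inm' = begin
  nm' * d ^ d                       ≤⟨ *-monoˡ-≤ (d ^ d) nm'≤N ⟩
  nm * (suc k ^ d * s ^ e) * d ^ d  ≡⟨ *-assoc nm _ (d ^ d) ⟩
  nm * (suc k ^ d * s ^ e * d ^ d)  ≡⟨ cong (nm *_) (m^n*[m*n]^o*n^n≡[m*n]^[n+o] (suc k) d e) ⟩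
  nm * s ^ s                        ∎
  where
  open ≤-Reasoning
  d e s : ℕ
  d = suc d₀
  e = k * d
  s = suc k * d
  nm'≤N : nm' ≤ nm * (suc k ^ d * s ^ e)
  nm'≤N = IsNm-≤ Inm' (IsNm⇒¬Choosable Inm ∘ Choosable-blowup d k)
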